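{- Let $G$ be a $C_5$-reseminant graph, where the vertices of $C_5$ are $1,\dots,5$ in cyclic order, and for $i\in\{1,\dots,5\}$ let $V_i$ be the set of true twins of vertex $i$ in $G$ (including $i$), with $h_i=|V_i|$. Let $H=\{\varphi\in\mathrm{Aut}(G):\varphi(V_i)=V_i\text{ for all }i\}\cong S_{h_1}\times\cdots\times S_{h_5}$. Then: (1) If $G$ is $k$-regular for some $k$, then $h_1=h_2=h_3=h_4=h_5=:h$ and $\mathrm{Aut}(G)/H\cong\mathrm{Aut}(C_5)\cong D_5$, where $H\cong S_h\times S_h\times S_h\times S_h\times S_h$. (2) If $G$ is not regular and $G$ has no reflection, then $\mathrm{Aut}(G)=H\cong S_{h_1}\times\cdots\times S_{h_5}$. (3) If $G$ is not regular and $G$ has at least one reflection, then $\mathrm{Aut}(G)/H\cong\mathbb{Z}_2$.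
   Context: All graphs are finite, simple and undirected. $C_5$ is the 5-cycle and $D_5$ is the dihedral group of order 10. $N_1[v]$ is the closed neighborhood of $v$; vertices $u,v$ are true twins if $N_1[u]=N_1[v]$. Vertex duplication of $w$ adds a new vertex $w'$ adjacent exactly to the vertices of $N_1[w]$. A $C_5$-reseminant graph is obtained from $C_5$ by finitely many (possibly zero) vertex duplications. Every automorphism of $G$ permutes the sets $V_1,\dots,V_5$, inducing a permutation of $\{1,\dots,5\}$ that is an automorphism of $C_5$; a reflection of $G$ means an automorphism of $G$ whose induced permutation of $\{1,\dots,5\}$ is a reflection of the 5-cycle. -}

module Defs where

open import Level using (0ℓ)
open import Data.Nat using (ℕ; zero; suc; _+_; _∸_)
open import Data.Nat.DivMod using (_mod_)
open import Data.Bool using (Bool; true; false; _∨_; _xor_; not; if_then_else_)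
open import Data.Fin using (Fin; zero; suc; toℕ)
open import Data.Fin.Properties using (_≟_; all?)
open import Data.Fin.Permutation
  using (Permutation′; _⟨$⟩ʳ_; _⟨$⟩ˡ_; _∘ₚ_; flip; inverseˡ; inverseʳ)
  renaming (id to idₚ)
open import Data.List using (List; length; filter; allFin)
open import Data.Product using (Σ; ∃; ∃-syntax; _×_; _,_; proj₁; proj₂)
open import Function using (_∘_)
open import Function.Bundles using (_⇔_; mk⇔; Equivalence)
open import Function.Properties.Equivalence renaming (trans to ⇔-trans; sym to ⇔-sym) using ()
open import Relation.Nullary using (¬_; Dec; yes; no; does)
open import Relation.Binary.PropositionalEquality
  using (_≡_; refl; sym; trans; cong; cong₂; subst)
open import Algebra.Bundles.Raw using (RawGroup)
open import Algebra.Morphism.Structures using (module GroupMorphisms)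
import Algebra.Construct.DirectProduct as DP

-- Finite simple graphs on the vertex set Fin n, given by a Boolean
-- adjacency function.  (All graphs considered below are built from C₅
-- by vertex duplication and are therefore automatically simple.)

Graph : ℕ → Set
Graph n = Fin n → Fin n → Bool

_==_ : ∀ {n} → Fin n → Fin n → Bool
i == j = does (i ≟ j)

-- The 5-cycle on vertices 0,1,2,3,4 (the paper's 1,…,5) in cyclic order.
C₅ : Graph 5
C₅ i j = (((toℕ i + 1) mod 5) == j) ∨ (((toℕ j + 1) mod 5) == i)

-- Vertex duplication of w: the new vertex is 0, old vertex v becomes suc v,
-- and the new vertex is adjacent exactly to the vertices of N₁[w].
duplicate : ∀ {n} → Graph n → Fin n → Graph (suc n)
duplicate G w zero    zero    = false
duplicate G w zero    (suc v) = (w == v) ∨ G w v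
duplicate G w (suc u) zero    = (u == w) ∨ G u w
duplicate G w (suc u) (suc v) = G u v

-- C₅-reseminant graphs, together with the embedding ι : Fin 5 → Fin n
-- recording where the original vertices of C₅ sit in G.
data Reseminant : (n : ℕ) → Graph n → (Fin 5 → Fin n) → Set where
  base : Reseminant 5 C₅ (λ i → i)
  dup  : ∀ {n G ι} → Reseminant n G ι → (w : Fin n) →
         Reseminant (suc n) (duplicate G w) (suc ∘ ι)

N₁ : ∀ {n} → Graph n → Fin n → Fin n → Bool
N₁ G v x = (x == v) ∨ G v x

TrueTwins : ∀ {n} → Graph n → Fin n → Fin n → Set
TrueTwins G u v = ∀ x → N₁ G u x ≡ N₁ G v x

trueTwins? : ∀ {n} (G : Graph n) u v → Dec (TrueTwins G u v)
trueTwins? G u v = all? (λ x → Data.Bool._≟_ (N₁ G u x) (N₁ G v x))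
  where import Data.Bool

InV : ∀ {n} → Graph n → (Fin 5 → Fin n) → Fin 5 → Fin n → Set
InV G ι i v = TrueTwins G (ι i) v

h : ∀ {n} → Graph n → (Fin 5 → Fin n) → Fin 5 → ℕ
h G ι i = length (filter (trueTwins? G (ι i)) (allFin _))

degree : ∀ {n} → Graph n → Fin n → ℕ
degree G v = length (filter (λ x → Data.Bool._≟_ (G v x) true) (allFin _))
  where import Data.Bool

Regular : ∀ {n} → Graph n → ℕ → Set
Regular G k = ∀ v → degree G v ≡ k

-- Automorphisms and the group Aut(G)  (φ ∙ ψ = φ ∘ ψ)

record Aut {n} (G : Graph n) : Set where
  constructor mkAut
  field
    perm      : Permutation′ n
    preserves : ∀ u v → G (perm ⟨$⟩ʳ u) (perm ⟨$⟩ʳ v) ≡ G u v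

  app : Fin n → Fin n
  app = perm ⟨$⟩ʳ_
open Aut public

idAut : ∀ {n} (G : Graph n) → Aut G
idAut G = mkAut idₚ (λ u v → refl)

compAut : ∀ {n} {G : Graph n} → Aut G → Aut G → Aut G
compAut φ ψ = mkAut (perm ψ ∘ₚ perm φ)
  (λ u v → trans (preserves φ _ _) (preserves ψ u v))

invAut : ∀ {n} {G : Graph n} → Aut G → Aut G
invAut {G = G} φ = mkAut (flip (perm φ)) λ u v →
  trans (sym (preserves φ _ _))
        (cong₂ G (inverseʳ (perm φ)) (inverseʳ (perm φ)))

AutRaw : ∀ {n} → Graph n → RawGroup 0ℓ 0ℓ
AutRaw G = record
  { Carrier = Aut G
  ; _≈_     = λ φ ψ → ∀ v → app φ v ≡ app ψ v
  ; _∙_     = compAut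
  ; ε       = idAut G
  ; _⁻¹     = invAut
  }

-- H = { φ ∈ Aut(G) : φ(V_i) = V_i for all i }.
-- For a bijection φ, φ(V_i) = V_i  iff  (v ∈ V_i ⇔ φ v ∈ V_i) for all v.

InH : ∀ {n} {G : Graph n} → (Fin 5 → Fin n) → Aut G → Set
InH {G = G} ι φ = ∀ i v → InV G ι i v ⇔ InV G ι i (app φ v)

InH-id : ∀ {n} {G : Graph n} (ι : Fin 5 → Fin n) → InH ι (idAut G)
InH-id ι i v = mk⇔ (λ x → x) (λ x → x)

InH-comp : ∀ {n} {G : Graph n} (ι : Fin 5 → Fin n) {φ ψ : Aut G} →
           InH ι φ → InH ι ψ → InH ι (compAut φ ψ)
InH-comp ι {φ} {ψ} p q i v = ⇔-trans (q i v) (p i (app ψ v))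

InH-inv : ∀ {n} {G : Graph n} (ι : Fin 5 → Fin n) {φ : Aut G} →
          InH ι φ → InH ι (invAut φ)
InH-inv {G = G} ι {φ} p i v =
  ⇔-sym (subst (λ y → InV G ι i (app (invAut φ) v) ⇔ InV G ι i y)
               (inverseʳ (perm φ)) (p i (app (invAut φ) v)))

HElt : ∀ {n} (G : Graph n) → (Fin 5 → Fin n) → Set
HElt G ι = Σ (Aut G) (InH {G = G} ι)

HRaw : ∀ {n} (G : Graph n) → (Fin 5 → Fin n) → RawGroup 0ℓ 0ℓ
HRaw G ι = record
  { Carrier = HElt G ι
  ; _≈_     = λ φ ψ → ∀ v → app (proj₁ φ) v ≡ app (proj₁ ψ) v
  ; _∙_     = comp
  ; ε       = idAut G , InH-id ι
  ; _⁻¹     = inv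
  }
  where
  comp : HElt G ι → HElt G ι → HElt G ι
  comp (φ , p) (ψ , q) = compAut φ ψ , InH-comp {G = G} ι {φ} {ψ} p q
  inv : HElt G ι → HElt G ι
  inv (φ , p) = invAut φ , InH-inv {G = G} ι {φ} p

-- The quotient group Aut(G)/H, presented as a setoid quotient:
-- same carrier and operations as Aut(G), with φ ≈ ψ iff φ⁻¹ψ ∈ H.
AutModH : ∀ {n} (G : Graph n) → (Fin 5 → Fin n) → RawGroup 0ℓ 0ℓ
AutModH G ι = record
  { Carrier = Aut G
  ; _≈_     = λ φ ψ → InH ι (compAut (invAut φ) ψ)
  ; _∙_     = compAut
  ; ε       = idAut G
  ; _⁻¹     = invAut
  }

SymRaw : ℕ → RawGroup 0ℓ 0ℓ
SymRaw m = record
  { Carrier = Permutation′ m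
  ; _≈_     = λ π ρ → ∀ v → π ⟨$⟩ʳ v ≡ ρ ⟨$⟩ʳ v
  ; _∙_     = λ π ρ → ρ ∘ₚ π
  ; ε       = idₚ
  ; _⁻¹     = flip
  }

_×ᴳ_ : RawGroup 0ℓ 0ℓ → RawGroup 0ℓ 0ℓ → RawGroup 0ℓ 0ℓ
_×ᴳ_ = DP.rawGroup
infixr 6 _×ᴳ_

SymProd : (Fin 5 → ℕ) → RawGroup 0ℓ 0ℓ
SymProd k = SymRaw (k zero) ×ᴳ SymRaw (k (suc zero)) ×ᴳ SymRaw (k (suc (suc zero)))
  ×ᴳ SymRaw (k (suc (suc (suc zero)))) ×ᴳ SymRaw (k (suc (suc (suc (suc zero)))))

-- D₅ = ⟨ r, s ∣ r⁵ = s² = 1, s r s = r⁻¹ ⟩ ; (a , e) stands for r^a s^e.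
_+₅_ : Fin 5 → Fin 5 → Fin 5
a +₅ b = (toℕ a + toℕ b) mod 5

-₅_ : Fin 5 → Fin 5
-₅ a = (5 ∸ toℕ a) mod 5

D₅ : RawGroup 0ℓ 0ℓ
D₅ = record
  { Carrier = Fin 5 × Bool
  ; _≈_     = _≡_
  ; _∙_     = λ { (a , e) (b , f) → (a +₅ (if e then -₅ b else b)) , (e xor f) }
  ; ε       = zero , false
  ; _⁻¹     = λ { (a , false) → (-₅ a , false) ; (a , true) → (a , true) }
  }

ℤ₂ : RawGroup 0ℓ 0ℓ
ℤ₂ = record
  { Carrier = Bool
  ; _≈_     = _≡_
  ; _∙_     = _xor_
  ; ε       = false
  ; _⁻¹     = λ b → b
  }

_≅_ : RawGroup 0ℓ 0ℓ → RawGroup 0ℓ 0ℓ → Set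
A ≅ B = ∃[ f ] GroupMorphisms.IsGroupIsomorphism A B f
infix 4 _≅_

IsReflection₅ : (Fin 5 → Fin 5) → Set
IsReflection₅ σ = ∃[ a ] ∀ j → σ j ≡ a +₅ (-₅ j)

Induces : ∀ {n} {G : Graph n} → (Fin 5 → Fin n) → Aut G → (Fin 5 → Fin 5) → Set
Induces {G = G} ι φ σ = ∀ i v → InV G ι i v ⇔ InV G ι (σ i) (app φ v)

HasReflection : ∀ {n} (G : Graph n) → (Fin 5 → Fin n) → Set
HasReflection G ι = ∃[ φ ] ∃[ σ ] Induces {G = G} ι φ σ × IsReflection₅ σ

-- Every C₅-reseminant graph is a blow-up of C₅: colouring each vertex by the vertex of C₅ it
-- descends from, two distinct vertices are adjacent exactly when their colours are equal or
-- adjacent in C₅. True twins are then exactly the vertices of equal colour, so an automorphism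
-- permutes the classes V_i and induces an automorphism of C₅; that one is dihedral, because an
-- injective endomap of the 5-cycle is determined by the images of two adjacent vertices. This
-- gives a homomorphism Aut(G) → Aut(C₅) ≅ D₅ with kernel H, and H acts on each class
-- independently, so H ≅ S_{h₁} × ⋯ × S_{h₅}.
-- Automorphisms preserve class sizes, and deg v + 1 = h_{i-1} + h_i + h_{i+1} for v ∈ V_i, so G is
-- regular iff all h_i are equal. If they are, every dihedral symmetry lifts to G. If not, the
-- image contains no nontrivial rotation (it would make the sizes constant); as two reflections
-- differ by a rotation, the image is trivial or {1, s} for a single reflection s.

module Submission where

open import Defs
open import Level using (0ℓ)
open import Data.Nat using (ℕ; zero; suc; _+_; _≤_; pred)
import Data.Nat as ℕ
open import Data.Nat.Properties using (+-assoc; +-comm; +-suc; +-cancelˡ-≡; ≤-antisym; +-0-commutativeMonoid)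
open import Data.Bool using (Bool; true; false; _∨_; _∧_; not; _xor_; if_then_else_)
open import Data.Bool.Properties using (xor-same) renaming (_≟_ to _≟ᴮ_)
open import Data.Fin using (Fin; zero; suc; toℕ; cast)
open import Data.Fin.Patterns using (0F; 1F; 2F; 3F; 4F)
open import Data.Fin.Properties using (_≟_; all?; any?; cast-involutive; injective⇒≤)
open import Data.Fin.Permutation using (Permutation′; permutation; _⟨$⟩ʳ_; _⟨$⟩ˡ_; inverseˡ; inverseʳ)
open import Data.List using (length; filter; tabulate)
open import Data.Product using (Σ-syntax; ∃-syntax; _×_; _,_; proj₁; proj₂)
open import Data.Product.Properties using (≡-dec)
open import Data.Sum using (_⊎_; inj₁; inj₂)
open import Function using (_∘_)
open import Function.Bundles using (mk⇔; Equivalence)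
open import Relation.Nullary using (Dec; yes; no; ¬_; contradiction)
open import Relation.Nullary.Decidable using (toWitness; map′; ¬?; _→-dec_; _⊎-dec_)
open import Relation.Unary using (Pred; Decidable)
open import Relation.Binary.PropositionalEquality
open import Algebra.Bundles.Raw using (RawGroup)
open import Axiom.UniquenessOfIdentityProofs using (module Decidable⇒UIP)
open import Algebra.Properties.CommutativeMonoid.Sum +-0-commutativeMonoid using (sum; sum-cong-≗; ∑-distrib-+)

open RawGroup D₅ using () renaming (_∙_ to _∙ᴰ_; ε to εᴰ; _⁻¹ to _⁻¹ᴰ)

mk≅ : (A B : RawGroup 0ℓ 0ℓ) → let module A = RawGroup A; module B = RawGroup B in
      (f : A.Carrier → B.Carrier) →
      (∀ {x y} → x A.≈ y → f x B.≈ f y) →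
      (∀ x y → f (x A.∙ y) B.≈ (f x B.∙ f y)) →
      f A.ε B.≈ B.ε →
      (∀ x → f (x A.⁻¹) B.≈ (f x B.⁻¹)) →
      (∀ {x y} → f x B.≈ f y → x A.≈ y) →
      (∀ y → ∃[ x ] (∀ {z} → z A.≈ x → f z B.≈ y)) →
      A ≅ B
mk≅ A B f f-cong homo ε-homo ⁻¹-homo injective surjective = f , record
  { isGroupMonomorphism = record
    { isGroupHomomorphism = record
      { isMonoidHomomorphism = record
        { isMagmaHomomorphism = record
          { isRelHomomorphism = record { cong = f-cong }
          ; homo = homo }
        ; ε-homo = ε-homo }
      ; ⁻¹-homo = ⁻¹-homo }
    ; injective = injective }
  ; surjective = surjective
  }

Π₅ : (Fin 5 → Set) → Set
Π₅ P = P 0F × P 1F × P 2F × P 3F × P 4F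

tabulate₅ : ∀ {P : Fin 5 → Set} → (∀ i → P i) → Π₅ P
tabulate₅ p = p 0F , p 1F , p 2F , p 3F , p 4F

lookup₅ : ∀ {P : Fin 5 → Set} → Π₅ P → ∀ i → P i
lookup₅ (p₀ , _) 0F = p₀
lookup₅ (_ , p₁ , _) 1F = p₁
lookup₅ (_ , _ , p₂ , _) 2F = p₂
lookup₅ (_ , _ , _ , p₃ , _) 3F = p₃
lookup₅ (_ , _ , _ , _ , p₄) 4F = p₄

==-refl : ∀ {n} (u : Fin n) → (u == u) ≡ true
==-refl u with u ≟ u
... | yes _ = refl
... | no u≢u = contradiction refl u≢u

==-≢ : ∀ {n} {u v : Fin n} → u ≢ v → (u == v) ≡ false
==-≢ {u = u} {v} u≢v with u ≟ v
... | yes u≡v = contradiction u≡v u≢v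
... | no _ = refl

==⇒≡ : ∀ {n} {u v : Fin n} → (u == v) ≡ true → u ≡ v
==⇒≡ {u = u} {v} eq with u ≟ v
... | yes u≡v = u≡v

injective-preserves-== : ∀ {m n} {f : Fin m → Fin n} → (∀ {u v} → f u ≡ f v → u ≡ v) →
                         ∀ u v → (f u == f v) ≡ (u == v)
injective-preserves-== {f = f} f-injective u v with u ≟ v
... | yes refl = ==-refl (f u)
... | no u≢v = ==-≢ (u≢v ∘ f-injective)

app-injective : ∀ {n} {G : Graph n} (φ : Aut G) {u v} → app φ u ≡ app φ v → u ≡ v
app-injective φ {u} {v} eq =
  trans (sym (inverseˡ (perm φ))) (trans (cong (perm φ ⟨$⟩ˡ_) eq) (inverseˡ (perm φ)))

Aut-preserves-N₁ : ∀ {n} {G : Graph n} (φ : Aut G) u v → N₁ G (app φ u) (app φ v) ≡ N₁ G u v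
Aut-preserves-N₁ φ u v =
  cong₂ _∨_ (injective-preserves-== (app-injective φ) v u) (preserves φ u v)

all-Bool? : {P : Bool → Set} → (∀ b → Dec (P b)) → Dec (∀ b → P b)
all-Bool? P? with P? false | P? true
... | yes p | yes q = yes λ { false → p ; true → q }
... | no ¬p | _ = no λ f → ¬p (f false)
... | _ | no ¬q = no λ f → ¬q (f true)

all-D₅? : {P : Fin 5 × Bool → Set} → (∀ d → Dec (P d)) → Dec (∀ d → P d)
all-D₅? P? = map′ (λ f (a , s) → f a s) (λ f a s → f (a , s)) (all? λ a → all-Bool? λ s → P? (a , s))

dihedral : Fin 5 × Bool → Fin 5 → Fin 5
dihedral (a , s) j = a +₅ (if s then -₅ j else j)

dihedralOf : (Fin 5 → Fin 5) → Fin 5 × Bool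
dihedralOf σ = σ 0F , not (σ 1F == (σ 0F +₅ 1F))

nextOnCycle : Fin 5 → Fin 5 → Fin 5
nextOnCycle x y = y +₅ (y +₅ (-₅ x))

walk : Fin 5 → Fin 5 → Fin 5 → Fin 5
walk a b 0F = a
walk a b 1F = b
walk a b 2F = nextOnCycle a b
walk a b 3F = nextOnCycle b (nextOnCycle a b)
walk a b 4F = nextOnCycle (nextOnCycle a b) (nextOnCycle b (nextOnCycle a b))

succ₅ pred₅ : Fin 5 → Fin 5
succ₅ i = i +₅ 1F
pred₅ i = i +₅ 4F

indicator : Bool → ℕ
indicator b = if b then 1 else 0

rotations : Fin 5 → ℕ → Fin 5
rotations a zero = 0F
rotations a (suc t) = a +₅ rotations a t

opaque
  N₁-C₅-refl : ∀ i → N₁ C₅ i i ≡ true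
  N₁-C₅-refl = toWitness {a? = all? λ i → N₁ C₅ i i ≟ᴮ true} _

  C₅-twinFree : ∀ i j → (∀ k → N₁ C₅ i k ≡ N₁ C₅ j k) → i ≡ j
  C₅-twinFree = toWitness {a? = all? λ i → all? λ j →
    all? (λ k → N₁ C₅ i k ≟ᴮ N₁ C₅ j k) →-dec (i ≟ j)} _

  C₅-via-N₁ : ∀ x y → C₅ x y ≡ not (x == y) ∧ N₁ C₅ x y
  C₅-via-N₁ = toWitness {a? = all? λ x → all? λ y → C₅ x y ≟ᴮ (not (x == y) ∧ N₁ C₅ x y)} _

  C₅-step : ∀ x y z → C₅ x y ≡ true → C₅ y z ≡ true → z ≡ x ⊎ z ≡ nextOnCycle x y
  C₅-step = toWitness {a? = all? λ x → all? λ y → all? λ z →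
    (C₅ x y ≟ᴮ true) →-dec ((C₅ y z ≟ᴮ true) →-dec ((z ≟ x) ⊎-dec (z ≟ nextOnCycle x y)))} _

  walk-dihedral : ∀ a b → C₅ a b ≡ true → ∀ j → walk a b j ≡ dihedral (dihedralOf (walk a b)) j
  walk-dihedral = toWitness {a? = all? λ a → all? λ b → (C₅ a b ≟ᴮ true) →-dec
    all? (λ j → walk a b j ≟ dihedral (dihedralOf (walk a b)) j)} _

  dihedralOf-dihedral : ∀ d → dihedralOf (dihedral d) ≡ d
  dihedralOf-dihedral = toWitness {a? = all-D₅? λ d → ≡-dec _≟_ _≟ᴮ_ (dihedralOf (dihedral d)) d} _

  dihedral-∙ : ∀ d d' j → dihedral (d ∙ᴰ d') j ≡ dihedral d (dihedral d' j)
  dihedral-∙ = toWitness {a? = all-D₅? λ d → all-D₅? λ d' → all? λ j →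
    dihedral (d ∙ᴰ d') j ≟ dihedral d (dihedral d' j)} _

  dihedral-ε : ∀ j → dihedral εᴰ j ≡ j
  dihedral-ε = toWitness {a? = all? λ j → dihedral εᴰ j ≟ j} _

  dihedral-inverseʳ : ∀ d j → dihedral d (dihedral (d ⁻¹ᴰ) j) ≡ j
  dihedral-inverseʳ = toWitness {a? = all-D₅? λ d → all? λ j → dihedral d (dihedral (d ⁻¹ᴰ) j) ≟ j} _

  dihedral-inverseˡ : ∀ d j → dihedral (d ⁻¹ᴰ) (dihedral d j) ≡ j
  dihedral-inverseˡ = toWitness {a? = all-D₅? λ d → all? λ j → dihedral (d ⁻¹ᴰ) (dihedral d j) ≟ j} _

  dihedral-preserves-C₅ : ∀ d u v → C₅ (dihedral d u) (dihedral d v) ≡ C₅ u v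
  dihedral-preserves-C₅ = toWitness {a? = all-D₅? λ d → all? λ u → all? λ v →
    C₅ (dihedral d u) (dihedral d v) ≟ᴮ C₅ u v} _

  rotations-transitive : ∀ a → a ≢ 0F → ∀ j → ∃[ t ] rotations a (toℕ {5} t) ≡ j
  rotations-transitive = toWitness {a? = all? λ a → ¬? (a ≟ 0F) →-dec
    all? λ j → any? λ t → rotations a (toℕ t) ≟ j} _

  N₁-C₅-indicator : ∀ i j → indicator (N₁ C₅ i j) ≡
                    indicator (j == pred₅ i) + indicator (j == i) + indicator (j == succ₅ i)
  N₁-C₅-indicator = toWitness {a? = all? λ i → all? λ j →
    indicator (N₁ C₅ i j) ℕ.≟ indicator (j == pred₅ i) + indicator (j == i) + indicator (j == succ₅ i)} _

  pred₅-succ₅ : ∀ j → pred₅ (succ₅ j) ≡ j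
  pred₅-succ₅ = toWitness {a? = all? λ j → pred₅ (succ₅ j) ≟ j} _

  succ₅³ : ∀ j → succ₅ (succ₅ (succ₅ j)) ≡ 3F +₅ j
  succ₅³ = toWitness {a? = all? λ j → succ₅ (succ₅ (succ₅ j)) ≟ (3F +₅ j)} _

  proj₂-⁻¹ᴰ : ∀ d → proj₂ (d ⁻¹ᴰ) ≡ proj₂ d
  proj₂-⁻¹ᴰ = toWitness {a? = all-D₅? λ d → proj₂ (d ⁻¹ᴰ) ≟ᴮ proj₂ d} _

dihedralOf-unique : ∀ {σ} d → (∀ j → σ j ≡ dihedral d j) → dihedralOf σ ≡ d
dihedralOf-unique d σ≗d =
  trans (cong₂ (λ a b → a , not (b == (a +₅ 1F))) (σ≗d 0F) (σ≗d 1F)) (dihedralOf-dihedral d)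

-- An injective endomap of C₅ is pinned down by the images of 0 and 1: every further vertex
-- is the neighbour of its predecessor other than the one before.
module _ {σ : Fin 5 → Fin 5} (σ-injective : ∀ {i j} → σ i ≡ σ j → i ≡ j)
         (σ-preserves-C₅ : ∀ i j → C₅ (σ i) (σ j) ≡ C₅ i j) where

  private
    step : ∀ {x y z} → C₅ x y ≡ true → C₅ y z ≡ true → x ≢ z → σ z ≡ nextOnCycle (σ x) (σ y)
    step {x} {y} {z} xy yz x≢z
      with C₅-step (σ x) (σ y) (σ z) (trans (σ-preserves-C₅ x y) xy) (trans (σ-preserves-C₅ y z) yz)
    ... | inj₁ σz≡σx = contradiction (sym (σ-injective σz≡σx)) x≢z
    ... | inj₂ σz≡next = σz≡next

    σ₂ : σ 2F ≡ walk (σ 0F) (σ 1F) 2F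
    σ₂ = step {0F} {1F} refl refl λ ()

    σ₃ : σ 3F ≡ walk (σ 0F) (σ 1F) 3F
    σ₃ = trans (step {1F} {2F} refl refl λ ()) (cong (nextOnCycle (σ 1F)) σ₂)

    σ≡walk : ∀ j → σ j ≡ walk (σ 0F) (σ 1F) j
    σ≡walk 0F = refl
    σ≡walk 1F = refl
    σ≡walk 2F = σ₂
    σ≡walk 3F = σ₃
    σ≡walk 4F = trans (step {2F} {3F} refl refl λ ()) (cong₂ nextOnCycle σ₂ σ₃)

  C₅-endomorphism-dihedral : ∀ j → σ j ≡ dihedral (dihedralOf σ) j
  C₅-endomorphism-dihedral j = trans (σ≡walk j) (walk-dihedral (σ 0F) (σ 1F) (σ-preserves-C₅ 0F 1F) j)

rotation-invariant⇒constant : (x : Fin 5 → ℕ) {a : Fin 5} → a ≢ 0F →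
                              (∀ j → x (a +₅ j) ≡ x j) → ∀ j → x j ≡ x 0F
rotation-invariant⇒constant x {a} a≢0 x-invariant j with rotations-transitive a a≢0 j
... | t , refl = orbit (toℕ t)
  where
  orbit : ∀ t → x (rotations a t) ≡ x 0F
  orbit zero = refl
  orbit (suc t) = trans (x-invariant (rotations a t)) (orbit t)

code : Aut C₅ → Fin 5 × Bool
code τ = dihedralOf (app τ)

Aut-C₅-dihedral : (τ : Aut C₅) → ∀ j → app τ j ≡ dihedral (code τ) j
Aut-C₅-dihedral τ = C₅-endomorphism-dihedral (app-injective τ) (preserves τ)

dihedralAut : Fin 5 × Bool → Aut C₅
dihedralAut d = mkAut (permutation (dihedral d) (dihedral (d ⁻¹ᴰ)) (dihedral-inverseʳ d) (dihedral-inverseˡ d))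
                      (dihedral-preserves-C₅ d)

code-cong : ∀ τ τ' → (∀ j → app τ j ≡ app τ' j) → code τ ≡ code τ'
code-cong τ τ' τ≗τ' = dihedralOf-unique (code τ') λ j → trans (τ≗τ' j) (Aut-C₅-dihedral τ' j)

code-injective : ∀ τ τ' → code τ ≡ code τ' → ∀ j → app τ j ≡ app τ' j
code-injective τ τ' eq j =
  trans (Aut-C₅-dihedral τ j) (trans (cong (λ d → dihedral d j) eq) (sym (Aut-C₅-dihedral τ' j)))

code-∙ : ∀ τ τ' → code (compAut τ τ') ≡ code τ ∙ᴰ code τ'
code-∙ τ τ' = dihedralOf-unique (code τ ∙ᴰ code τ') λ j → begin
  app τ (app τ' j)                           ≡⟨ cong (app τ) (Aut-C₅-dihedral τ' j) ⟩
  app τ (dihedral (code τ') j)               ≡⟨ Aut-C₅-dihedral τ _ ⟩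
  dihedral (code τ) (dihedral (code τ') j)   ≡⟨ dihedral-∙ (code τ) (code τ') j ⟨
  dihedral (code τ ∙ᴰ code τ') j             ∎
  where open ≡-Reasoning

code-ε : code (idAut C₅) ≡ εᴰ
code-ε = dihedralOf-unique εᴰ λ j → sym (dihedral-ε j)

code-⁻¹ : ∀ τ → code (invAut τ) ≡ code τ ⁻¹ᴰ
code-⁻¹ τ = dihedralOf-unique (code τ ⁻¹ᴰ) λ j →
  trans (cong (app (invAut τ)) (sym (τ-image j))) (inverseˡ (perm τ))
  where
  τ-image : ∀ j → app τ (dihedral (code τ ⁻¹ᴰ) j) ≡ j
  τ-image j = trans (Aut-C₅-dihedral τ _) (dihedral-inverseʳ (code τ) j)

Aut-C₅≅D₅ : AutRaw C₅ ≅ D₅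
Aut-C₅≅D₅ = mk≅ (AutRaw C₅) D₅ code (λ {τ} {τ'} → code-cong τ τ') code-∙ code-ε code-⁻¹
  (λ {τ} {τ'} → code-injective τ τ')
  λ d → dihedralAut d , λ {τ} τ≈d → dihedralOf-unique d τ≈d

count : ∀ {n} → (Fin n → Bool) → ℕ
count f = sum (indicator ∘ f)

count-cong : ∀ {n} {f g : Fin n → Bool} → (∀ x → f x ≡ g x) → count f ≡ count g
count-cong f≗g = sum-cong-≗ (cong indicator ∘ f≗g)

count-remove : ∀ {n} (f : Fin n → Bool) v → f v ≡ true →
               suc (count (λ x → not (v == x) ∧ f x)) ≡ count f
count-remove f zero fv≡true rewrite fv≡true = refl
count-remove f (suc v) fv≡true =
  trans (sym (+-suc (indicator (f zero)) _)) (cong (indicator (f zero) +_) (count-remove (f ∘ suc) v fv≡true))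

length-filter-tabulate : ∀ {m} n (g : Fin n → Fin m) {P : Pred (Fin m) 0ℓ} (P? : Decidable P)
                         (f : Fin m → Bool) → (∀ x → P x → f x ≡ true) → (∀ x → f x ≡ true → P x) →
                         length (filter P? (tabulate g)) ≡ count (f ∘ g)
length-filter-tabulate zero g P? f P⇒f f⇒P = refl
length-filter-tabulate (suc n) g P? f P⇒f f⇒P with P? (g zero) | f (g zero) in fg₀
... | yes _ | true = cong suc (length-filter-tabulate n (g ∘ suc) P? f P⇒f f⇒P)
... | yes p | false = contradiction (trans (sym (P⇒f _ p)) fg₀) λ ()
... | no ¬p | true = contradiction (f⇒P _ fg₀) ¬p
... | no _ | false = length-filter-tabulate n (g ∘ suc) P? f P⇒f f⇒P

classSize : ∀ {m n} → (Fin n → Fin m) → Fin m → ℕ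
classSize c i = count (λ v → c v == i)

-- index receives the class explicitly, with a proof of membership, so that its type is
-- Fin (k i) rather than Fin (k (c v)).
record Indexing {m n} (c : Fin n → Fin m) (k : Fin m → ℕ) : Set where
  field
    element        : ∀ i → Fin (k i) → Fin n
    index          : ∀ i v → c v ≡ i → Fin (k i)
    colour-element : ∀ i x → c (element i x) ≡ i
    element-index  : ∀ i v e → element i (index i v e) ≡ v
    index-element  : ∀ i x e → index i (element i x) e ≡ x

  index-cong : ∀ i {v w} (e : c v ≡ i) (e' : c w ≡ i) → v ≡ w → index i v e ≡ index i w e'
  index-cong i e e' refl = cong (index i _) (Decidable⇒UIP.≡-irrelevant _≟_ e e')

  element-injective : ∀ i {x y} → element i x ≡ element i y → x ≡ y
  element-injective i {x} {y} eq = begin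
    x                                          ≡⟨ index-element i x (colour-element i x) ⟨
    index i (element i x) (colour-element i x) ≡⟨ index-cong i _ _ eq ⟩
    index i (element i y) (colour-element i y) ≡⟨ index-element i y (colour-element i y) ⟩
    y                                          ∎
    where open ≡-Reasoning

  size-≤ : ∀ {f : Fin n → Fin n} → (∀ {u v} → f u ≡ f v → u ≡ v) →
           ∀ {i j} → (∀ v → c v ≡ i → c (f v) ≡ j) → k i ≤ k j
  size-≤ {f} f-injective {i} {j} f-maps = injective⇒≤ g-injective
    where
    g : Fin (k i) → Fin (k j)
    g x = index j (f (element i x)) (f-maps _ (colour-element i x))
    g-injective : ∀ {x y} → g x ≡ g y → x ≡ y
    g-injective {x} {y} eq = element-injective i (f-injective (begin
      f (element i x)          ≡⟨ element-index j _ _ ⟨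
      element j (g x)          ≡⟨ cong (element j) eq ⟩
      element j (g y)          ≡⟨ element-index j _ _ ⟩
      f (element i y)          ∎))
      where open ≡-Reasoning

indexing : ∀ {m n} (c : Fin n → Fin m) → Indexing c (classSize c)
indexing {n = zero} c = record
  { element = λ _ () ; index = λ _ () ; colour-element = λ _ () ; element-index = λ _ ()
  ; index-element = λ _ () }
indexing {n = suc n} c = record
  { element = element ; index = index ; colour-element = colour-element
  ; element-index = element-index ; index-element = index-element }
  where
  module I = Indexing (indexing (c ∘ suc))

  element : ∀ i → Fin (classSize c i) → Fin (suc n)
  element i x with c zero ≟ i
  element i zero    | yes _ = zero
  element i (suc x) | yes _ = suc (I.element i x)
  element i x       | no _  = suc (I.element i x)

  index : ∀ i v → c v ≡ i → Fin (classSize c i)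
  index i v e with c zero ≟ i
  index i zero    e | yes _    = zero
  index i (suc v) e | yes _    = suc (I.index i v e)
  index i zero    e | no c₀≢i = contradiction e c₀≢i
  index i (suc v) e | no _     = I.index i v e

  colour-element : ∀ i x → c (element i x) ≡ i
  colour-element i x with c zero ≟ i
  colour-element i zero    | yes c₀≡i = c₀≡i
  colour-element i (suc x) | yes _     = I.colour-element i x
  colour-element i x       | no _      = I.colour-element i x

  element-index : ∀ i v e → element i (index i v e) ≡ v
  element-index i v e with c zero ≟ i
  element-index i zero    e | yes _    = refl
  element-index i (suc v) e | yes _    = cong suc (I.element-index i v e)
  element-index i zero    e | no c₀≢i = contradiction e c₀≢i
  element-index i (suc v) e | no _     = cong suc (I.element-index i v e)

  index-element : ∀ i x e → index i (element i x) e ≡ x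
  index-element i x e with c zero ≟ i
  index-element i zero    e | yes _ = refl
  index-element i (suc x) e | yes _ = cong suc (I.index-element i x e)
  index-element i x       e | no _  = I.index-element i x e

reindex : ∀ {m n} {c : Fin n → Fin m} {k k' : Fin m → ℕ} →
          (∀ i → k i ≡ k' i) → Indexing c k → Indexing c k'
reindex {k = k} {k'} k≗k' I = record
  { element = λ i x → element i (cast (sym (k≗k' i)) x)
  ; index = λ i v e → cast (k≗k' i) (index i v e)
  ; colour-element = λ i x → colour-element i _
  ; element-index = λ i v e →
      trans (cong (element i) (cast-involutive (sym (k≗k' i)) (k≗k' i) _)) (element-index i v e)
  ; index-element = λ i x e →
      trans (cong (cast (k≗k' i)) (index-element i _ e)) (cast-involutive (k≗k' i) (sym (k≗k' i)) x)
  }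
  where open Indexing I

Aut-preserves-TrueTwins : ∀ {n} {G : Graph n} (φ : Aut G) {u v} →
                          TrueTwins G u v → TrueTwins G (app φ u) (app φ v)
Aut-preserves-TrueTwins {G = G} φ {u} {v} u≈v x = begin
  N₁ G (app φ u) x         ≡⟨ cong (N₁ G (app φ u)) (inverseʳ (perm φ)) ⟨
  N₁ G (app φ u) (app φ y) ≡⟨ Aut-preserves-N₁ φ u y ⟩
  N₁ G u y                 ≡⟨ u≈v y ⟩
  N₁ G v y                 ≡⟨ Aut-preserves-N₁ φ v y ⟨
  N₁ G (app φ v) (app φ y) ≡⟨ cong (N₁ G (app φ v)) (inverseʳ (perm φ)) ⟩
  N₁ G (app φ v) x         ∎
  where
  open ≡-Reasoning
  y = perm φ ⟨$⟩ˡ x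

record BlowUp {n} (G : Graph n) (ι : Fin 5 → Fin n) : Set where
  field
    colour    : Fin n → Fin 5
    colour-ι  : ∀ i → colour (ι i) ≡ i
    adjacency : ∀ u v → G u v ≡ not (u == v) ∧ N₁ C₅ (colour u) (colour v)

reseminant⇒blowUp : ∀ {n G ι} → Reseminant n G ι → BlowUp G ι
reseminant⇒blowUp base = record { colour = λ i → i ; colour-ι = λ _ → refl ; adjacency = C₅-via-N₁ }
reseminant⇒blowUp {suc n} (dup {G = G} R w) = record
  { colour = colour′ ; colour-ι = colour-ι ; adjacency = adjacency′ }
  where
  open BlowUp (reseminant⇒blowUp R)

  colour′ : Fin (suc n) → Fin 5
  colour′ zero    = colour w
  colour′ (suc v) = colour v

  adjacency′ : ∀ u v → duplicate G w u v ≡ not (u == v) ∧ N₁ C₅ (colour′ u) (colour′ v)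
  adjacency′ zero zero = refl
  adjacency′ zero (suc v) with w ≟ v | adjacency w v
  ... | yes refl | _ = sym (N₁-C₅-refl (colour w))
  ... | no _ | G-wv = G-wv
  adjacency′ (suc u) zero with u ≟ w | adjacency u w
  ... | yes refl | _ = sym (N₁-C₅-refl (colour u))
  ... | no _ | G-uw = G-uw
  adjacency′ (suc u) (suc v) = adjacency u v

module BlowUpAutomorphisms {n} {G : Graph n} {ι : Fin 5 → Fin n} (B : BlowUp G ι) where
  open BlowUp B
  open ≡-Reasoning

  N₁-colour : ∀ u x → N₁ G u x ≡ N₁ C₅ (colour u) (colour x)
  N₁-colour u x with x ≟ u | adjacency u x
  ... | yes refl | _ = sym (N₁-C₅-refl (colour u))
  ... | no x≢u | G-ux = trans G-ux (cong (λ b → not b ∧ N₁ C₅ (colour u) (colour x)) (==-≢ (x≢u ∘ sym)))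

  sameColour⇒trueTwins : ∀ {u v} → colour u ≡ colour v → TrueTwins G u v
  sameColour⇒trueTwins {u} {v} eq x =
    trans (N₁-colour u x) (trans (cong (λ a → N₁ C₅ a (colour x)) eq) (sym (N₁-colour v x)))

  trueTwins⇒sameColour : ∀ {u v} → TrueTwins G u v → colour u ≡ colour v
  trueTwins⇒sameColour {u} {v} u≈v = C₅-twinFree _ _ λ k → begin
    N₁ C₅ (colour u) k               ≡⟨ cong (N₁ C₅ (colour u)) (colour-ι k) ⟨
    N₁ C₅ (colour u) (colour (ι k))  ≡⟨ N₁-colour u (ι k) ⟨
    N₁ G u (ι k)                     ≡⟨ u≈v (ι k) ⟩
    N₁ G v (ι k)                     ≡⟨ N₁-colour v (ι k) ⟩
    N₁ C₅ (colour v) (colour (ι k))  ≡⟨ cong (N₁ C₅ (colour v)) (colour-ι k) ⟩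
    N₁ C₅ (colour v) k               ∎

  ∈V⇒colour : ∀ {i v} → InV G ι i v → colour v ≡ i
  ∈V⇒colour {i} v∈Vi = trans (sym (trueTwins⇒sameColour v∈Vi)) (colour-ι i)

  colour⇒∈V : ∀ {i v} → colour v ≡ i → InV G ι i v
  colour⇒∈V {i} eq = sameColour⇒trueTwins (trans (colour-ι i) (sym eq))

  induced : Aut G → Fin 5 → Fin 5
  induced φ i = colour (app φ (ι i))

  colour-app : ∀ φ v → colour (app φ v) ≡ induced φ (colour v)
  colour-app φ v = trueTwins⇒sameColour
    (Aut-preserves-TrueTwins φ (sameColour⇒trueTwins (sym (colour-ι (colour v)))))

  induced-∘ : ∀ φ ψ i → induced (compAut φ ψ) i ≡ induced φ (induced ψ i)
  induced-∘ φ ψ i = colour-app φ (app ψ (ι i))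

  induced-inverseˡ : ∀ φ i → induced (invAut φ) (induced φ i) ≡ i
  induced-inverseˡ φ i =
    trans (sym (induced-∘ (invAut φ) φ i)) (trans (cong colour (inverseˡ (perm φ))) (colour-ι i))

  induced-inverseʳ : ∀ φ i → induced φ (induced (invAut φ) i) ≡ i
  induced-inverseʳ φ i =
    trans (sym (induced-∘ φ (invAut φ) i)) (trans (cong colour (inverseʳ (perm φ))) (colour-ι i))

  induced-injective : ∀ φ {i j} → induced φ i ≡ induced φ j → i ≡ j
  induced-injective φ {i} {j} eq =
    trans (sym (induced-inverseˡ φ i)) (trans (cong (induced (invAut φ)) eq) (induced-inverseˡ φ j))

  induced-preserves-N₁ : ∀ φ i j → N₁ C₅ (induced φ i) (induced φ j) ≡ N₁ C₅ i j
  induced-preserves-N₁ φ i j = begin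
    N₁ C₅ (induced φ i) (induced φ j)    ≡⟨ N₁-colour _ _ ⟨
    N₁ G (app φ (ι i)) (app φ (ι j))     ≡⟨ Aut-preserves-N₁ φ _ _ ⟩
    N₁ G (ι i) (ι j)                     ≡⟨ N₁-colour _ _ ⟩
    N₁ C₅ (colour (ι i)) (colour (ι j))  ≡⟨ cong₂ (N₁ C₅) (colour-ι i) (colour-ι j) ⟩
    N₁ C₅ i j                            ∎

  induced-preserves-C₅ : ∀ φ i j → C₅ (induced φ i) (induced φ j) ≡ C₅ i j
  induced-preserves-C₅ φ i j = begin
    C₅ (induced φ i) (induced φ j)
      ≡⟨ C₅-via-N₁ (induced φ i) (induced φ j) ⟩
    not (induced φ i == induced φ j) ∧ N₁ C₅ (induced φ i) (induced φ j)
      ≡⟨ cong₂ (λ b x → not b ∧ x) (injective-preserves-== (induced-injective φ) i j)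
                                   (induced-preserves-N₁ φ i j) ⟩
    not (i == j) ∧ N₁ C₅ i j
      ≡⟨ C₅-via-N₁ i j ⟨
    C₅ i j
      ∎

  inducedAut : Aut G → Aut C₅
  inducedAut φ = mkAut (permutation (induced φ) (induced (invAut φ)) (induced-inverseʳ φ) (induced-inverseˡ φ))
                       (induced-preserves-C₅ φ)

  classAction : Aut G → Fin 5 × Bool
  classAction φ = code (inducedAut φ)

  induced-dihedral : ∀ φ j → induced φ j ≡ dihedral (classAction φ) j
  induced-dihedral φ = Aut-C₅-dihedral (inducedAut φ)

  InH⇒induced-id : ∀ χ → InH ι χ → ∀ i → induced χ i ≡ i
  InH⇒induced-id χ χ∈H i = ∈V⇒colour (Equivalence.to (χ∈H i (ι i)) (colour⇒∈V (colour-ι i)))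

  induced-id⇒InH : ∀ χ → (∀ i → induced χ i ≡ i) → InH ι χ
  induced-id⇒InH χ χ≗id i v = mk⇔
    (λ v∈Vi → colour⇒∈V (trans (colour-app χ v) (trans (χ≗id (colour v)) (∈V⇒colour v∈Vi))))
    (λ χv∈Vi → colour⇒∈V (trans (sym (χ≗id (colour v))) (trans (sym (colour-app χ v)) (∈V⇒colour χv∈Vi))))

  sameCoset⇒sameInduced : ∀ φ ψ → InH ι (compAut (invAut φ) ψ) → ∀ j → induced φ j ≡ induced ψ j
  sameCoset⇒sameInduced φ ψ φ⁻¹ψ∈H j = begin
    induced φ j
      ≡⟨ cong (induced φ) (InH⇒induced-id (compAut (invAut φ) ψ) φ⁻¹ψ∈H j) ⟨
    induced φ (induced (compAut (invAut φ) ψ) j)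
      ≡⟨ cong (induced φ) (induced-∘ (invAut φ) ψ j) ⟩
    induced φ (induced (invAut φ) (induced ψ j))
      ≡⟨ induced-inverseʳ φ _ ⟩
    induced ψ j
      ∎

  sameInduced⇒sameCoset : ∀ φ ψ → (∀ j → induced φ j ≡ induced ψ j) → InH ι (compAut (invAut φ) ψ)
  sameInduced⇒sameCoset φ ψ φ≗ψ = induced-id⇒InH (compAut (invAut φ) ψ) λ j → begin
    induced (compAut (invAut φ) ψ) j              ≡⟨ induced-∘ (invAut φ) ψ j ⟩
    induced (invAut φ) (induced ψ j)              ≡⟨ cong (induced (invAut φ)) (φ≗ψ j) ⟨
    induced (invAut φ) (induced φ j)              ≡⟨ induced-inverseˡ φ j ⟩
    j                                             ∎

  induced-induces : ∀ φ → Induces ι φ (induced φ)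
  induced-induces φ i v = mk⇔
    (λ v∈Vi → colour⇒∈V (trans (colour-app φ v) (cong (induced φ) (∈V⇒colour v∈Vi))))
    (λ φv∈V → colour⇒∈V (induced-injective φ (trans (sym (colour-app φ v)) (∈V⇒colour φv∈V))))

  induces⇒induced : ∀ {φ σ} → Induces ι φ σ → ∀ i → induced φ i ≡ σ i
  induces⇒induced φ-induces i = ∈V⇒colour (Equivalence.to (φ-induces i (ι i)) (colour⇒∈V (colour-ι i)))

  reflects : Aut G → Bool
  reflects φ = proj₂ (classAction φ)

  reflects-cong : ∀ φ ψ → (∀ j → induced φ j ≡ induced ψ j) → reflects φ ≡ reflects ψ
  reflects-cong φ ψ φ≗ψ = cong proj₂ (code-cong (inducedAut φ) (inducedAut ψ) φ≗ψ)

  reflects-∙ : ∀ φ ψ → reflects (compAut φ ψ) ≡ reflects φ xor reflects ψ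
  reflects-∙ φ ψ = cong proj₂ (trans (code-cong (inducedAut (compAut φ ψ)) (compAut (inducedAut φ) (inducedAut ψ))
                                                 (induced-∘ φ ψ))
                                     (code-∙ (inducedAut φ) (inducedAut ψ)))

  reflects-ε : reflects (idAut G) ≡ false
  reflects-ε = cong proj₂ (trans (code-cong (inducedAut (idAut G)) (idAut C₅) colour-ι) code-ε)

  reflects-⁻¹ : ∀ φ → reflects (invAut φ) ≡ reflects φ
  reflects-⁻¹ φ = trans (cong proj₂ (code-⁻¹ (inducedAut φ))) (proj₂-⁻¹ᴰ (classAction φ))

  reflects⇒HasReflection : ∀ φ → reflects φ ≡ true → HasReflection G ι
  reflects⇒HasReflection φ φ-reflects = φ , induced φ , induced-induces φ , proj₁ (classAction φ) , λ j →
    trans (induced-dihedral φ j) (cong (λ s → dihedral (proj₁ (classAction φ) , s) j) φ-reflects)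

  HasReflection⇒reflects : (r : HasReflection G ι) → reflects (proj₁ r) ≡ true
  HasReflection⇒reflects (φ , σ , φ-induces , a , σ-reflection) =
    cong proj₂ (dihedralOf-unique (a , true) λ j → trans (induces⇒induced {φ} φ-induces j) (σ-reflection j))

  reflects-false⇒rotation : ∀ φ → reflects φ ≡ false → ∀ j → induced φ j ≡ proj₁ (classAction φ) +₅ j
  reflects-false⇒rotation φ φ-rotates j =
    trans (induced-dihedral φ j) (cong (λ s → dihedral (proj₁ (classAction φ) , s) j) φ-rotates)

  size : Fin 5 → ℕ
  size = classSize colour

  h≡size : ∀ i → h G ι i ≡ size i
  h≡size i = length-filter-tabulate n (λ x → x) (trueTwins? G (ι i)) (λ v → colour v == i)
    (λ x x∈Vi → trans (cong (colour x ==_) (sym (∈V⇒colour x∈Vi))) (==-refl (colour x)))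
    (λ x eq → colour⇒∈V (==⇒≡ eq))

  size-induced : ∀ φ i → size (induced φ i) ≡ size i
  size-induced φ i = ≤-antisym
    (size-≤ (app-injective (invAut φ)) λ v eq →
      trans (colour-app (invAut φ) v) (trans (cong (induced (invAut φ)) eq) (induced-inverseˡ φ i)))
    (size-≤ (app-injective φ) λ v eq → trans (colour-app φ v) (cong (induced φ) eq))
    where open Indexing (indexing colour)

  sizesAround : Fin 5 → ℕ
  sizesAround i = size (pred₅ i) + size i + size (succ₅ i)

  degree-colour : ∀ v → suc (degree G v) ≡ sizesAround (colour v)
  degree-colour v = begin
    suc (degree G v)
      ≡⟨ cong suc (length-filter-tabulate n (λ x → x) (λ x → G v x ≟ᴮ true) (G v) (λ _ e → e) (λ _ e → e)) ⟩
    suc (count (G v))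
      ≡⟨ cong suc (count-cong (adjacency v)) ⟩
    suc (count (λ x → not (v == x) ∧ N₁ C₅ (colour v) (colour x)))
      ≡⟨ count-remove _ v (N₁-C₅-refl (colour v)) ⟩
    count (λ x → N₁ C₅ (colour v) (colour x))
      ≡⟨ sum-cong-≗ (λ x → N₁-C₅-indicator (colour v) (colour x)) ⟩
    sum (λ x → at (pred₅ (colour v)) x + at (colour v) x + at (succ₅ (colour v)) x)
      ≡⟨ ∑-distrib-+ (λ x → at (pred₅ (colour v)) x + at (colour v) x) (at (succ₅ (colour v))) ⟩
    sum (λ x → at (pred₅ (colour v)) x + at (colour v) x) + size (succ₅ (colour v))
      ≡⟨ cong (_+ size (succ₅ (colour v))) (∑-distrib-+ (at (pred₅ (colour v))) (at (colour v))) ⟩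
    sizesAround (colour v)
      ∎
    where
    at : Fin 5 → Fin n → ℕ
    at i x = indicator (colour x == i)

  -- Equal neighbourhood sums at succ j and succ (succ j) force size j ≡ size (j + 3), and a
  -- rotation by 3 moves every vertex of C₅ to every other.
  regular⇒equalSizes : ∃[ k ] Regular G k → ∀ i → size i ≡ size 0F
  regular⇒equalSizes (k , regular) = rotation-invariant⇒constant size {3F} (λ ()) λ j →
    sym (cancel (size j) (size (succ₅ j)) (size (succ₅ (succ₅ j))) (size (3F +₅ j)) (begin
      size j + size (succ₅ j) + size (succ₅ (succ₅ j))
        ≡⟨ cong (λ a → size a + size (succ₅ j) + size (succ₅ (succ₅ j))) (pred₅-succ₅ j) ⟨
      sizesAround (succ₅ j)
        ≡⟨ trans (around≡ (succ₅ j)) (sym (around≡ (succ₅ (succ₅ j)))) ⟩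
      sizesAround (succ₅ (succ₅ j))
        ≡⟨ cong₂ (λ a b → size a + size (succ₅ (succ₅ j)) + size b) (pred₅-succ₅ (succ₅ j)) (succ₅³ j) ⟩
      size (succ₅ j) + size (succ₅ (succ₅ j)) + size (3F +₅ j)
        ∎))
    where
    around≡ : ∀ i → sizesAround i ≡ suc k
    around≡ i = trans (cong sizesAround (sym (colour-ι i)))
                      (trans (sym (degree-colour (ι i))) (cong suc (regular (ι i))))
    cancel : ∀ a b c d → a + b + c ≡ b + c + d → a ≡ d
    cancel a b c d eq = +-cancelˡ-≡ (b + c) a d (trans (+-comm (b + c) a) (trans (sym (+-assoc a b c)) eq))

  equalSizes⇒regular : (∀ i → size i ≡ size 0F) → ∃[ k ] Regular G k
  equalSizes⇒regular equal = pred (sizesAround 0F) , λ v → cong pred (trans (degree-colour v) (around≡ (colour v)))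
    where
    same : ∀ i j → size i ≡ size j
    same i j = trans (equal i) (sym (equal j))
    around≡ : ∀ i → sizesAround i ≡ sizesAround 0F
    around≡ i = cong₂ _+_ (cong₂ _+_ (same _ _) (same _ _)) (same _ _)

  irregular-rotation⇒InH : ¬ (∃[ k ] Regular G k) → ∀ φ → reflects φ ≡ false → InH ι φ
  irregular-rotation⇒InH irregular φ φ-rotates with proj₁ (classAction φ) ≟ 0F
  ... | yes a≡0 = induced-id⇒InH φ λ j →
    trans (reflects-false⇒rotation φ φ-rotates j) (trans (cong (_+₅ j) a≡0) (dihedral-ε j))
  ... | no a≢0 = contradiction (equalSizes⇒regular (rotation-invariant⇒constant size a≢0 λ j →
    trans (cong size (sym (reflects-false⇒rotation φ φ-rotates j))) (size-induced φ j))) irregular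

  irregular⇒InH : ¬ (∃[ k ] Regular G k) → ¬ HasReflection G ι → ∀ φ → InH ι φ
  irregular⇒InH irregular noReflection φ with reflects φ in φ-reflects
  ... | false = irregular-rotation⇒InH irregular φ φ-reflects
  ... | true = contradiction (reflects⇒HasReflection φ φ-reflects) noReflection

  blowUpAut : (τ : Aut C₅) (f g : Fin n → Fin n) → (∀ y → f (g y) ≡ y) → (∀ x → g (f x) ≡ x) →
              (∀ v → colour (f v) ≡ app τ (colour v)) → Σ[ φ ∈ Aut G ] (∀ i → induced φ i ≡ app τ i)
  blowUpAut τ f g fg gf colour-f =
    mkAut (permutation f g fg gf) f-preserves , λ i → trans (colour-f (ι i)) (cong (app τ) (colour-ι i))
    where
    f-injective : ∀ {u v} → f u ≡ f v → u ≡ v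
    f-injective {u} {v} eq = trans (sym (gf u)) (trans (cong g eq) (gf v))
    f-preserves : ∀ u v → G (f u) (f v) ≡ G u v
    f-preserves u v = begin
      G (f u) (f v)                                           ≡⟨ adjacency (f u) (f v) ⟩
      not (f u == f v) ∧ N₁ C₅ (colour (f u)) (colour (f v))
        ≡⟨ cong₂ (λ b x → not b ∧ x) (injective-preserves-== f-injective u v)
                 (trans (cong₂ (N₁ C₅) (colour-f u) (colour-f v)) (Aut-preserves-N₁ τ _ _)) ⟩
      not (u == v) ∧ N₁ C₅ (colour u) (colour v)              ≡⟨ adjacency u v ⟨
      G u v                                                   ∎

  module _ {K : ℕ} (E : Indexing colour (λ _ → K)) where
    open Indexing E

    private
      index-colour : ∀ v {i} (e : colour v ≡ i) → index (colour v) v refl ≡ index i v e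
      index-colour v refl = refl

      move : (Fin 5 → Fin 5) → Fin n → Fin n
      move σ v = element (σ (colour v)) (index (colour v) v refl)

      move-move : ∀ {σ σ'} → (∀ i → σ (σ' i) ≡ i) → ∀ v → move σ (move σ' v) ≡ v
      move-move {σ} {σ'} σσ' v = trans
        (cong₂ element (trans (cong σ (colour-element _ _)) (σσ' (colour v)))
                       (trans (index-colour w (colour-element _ _)) (index-element _ _ _)))
        (element-index _ v refl)
        where w = move σ' v

    liftAut : (τ : Aut C₅) → Σ[ φ ∈ Aut G ] (∀ i → induced φ i ≡ app τ i)
    liftAut τ = blowUpAut τ (move (app τ)) (move (app (invAut τ)))
      (move-move {app τ} {app (invAut τ)} (λ _ → inverseʳ (perm τ)))
      (move-move {app (invAut τ)} {app τ} (λ _ → inverseˡ (perm τ))) (λ v → colour-element _ _)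

  H-preserves-colour : (χ : HElt G ι) → ∀ v → colour (app (proj₁ χ) v) ≡ colour v
  H-preserves-colour (χ , χ∈H) v = trans (colour-app χ v) (InH⇒induced-id χ χ∈H (colour v))

  module _ {k : Fin 5 → ℕ} (E : Indexing colour k) where
    open Indexing E
    open RawGroup (HRaw G ι) using () renaming (_∙_ to _∙ᴴ_; ε to εᴴ; _⁻¹ to _⁻¹ᴴ; _≈_ to _≈ᴴ_)

    restrict : HElt G ι → (i : Fin 5) → Fin (k i) → Fin (k i)
    restrict χ i x = index i (app (proj₁ χ) (element i x)) (trans (H-preserves-colour χ _) (colour-element i x))

    element-restrict : ∀ χ i x → element i (restrict χ i x) ≡ app (proj₁ χ) (element i x)
    element-restrict χ i x = element-index i _ _

    restrict-unique : ∀ χ i {x y} → element i y ≡ app (proj₁ χ) (element i x) → restrict χ i x ≡ y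
    restrict-unique χ i eq = element-injective i (trans (element-restrict χ i _) (sym eq))

    classPermutation : HElt G ι → (i : Fin 5) → Permutation′ (k i)
    classPermutation χ i = permutation (restrict χ i) (restrict (χ ⁻¹ᴴ) i)
      (λ y → restrict-unique χ i (sym (trans (cong (app (proj₁ χ)) (element-restrict (χ ⁻¹ᴴ) i y))
                                             (inverseʳ (perm (proj₁ χ))))))
      (λ y → restrict-unique (χ ⁻¹ᴴ) i (sym (trans (cong (app (proj₁ (χ ⁻¹ᴴ))) (element-restrict χ i y))
                                                    (inverseˡ (perm (proj₁ χ))))))

    restrict-cong : ∀ χ χ' → χ ≈ᴴ χ' → ∀ i x → restrict χ i x ≡ restrict χ' i x
    restrict-cong χ χ' χ≈χ' i x = restrict-unique χ i (trans (element-restrict χ' i x) (sym (χ≈χ' _)))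

    restrict-∙ : ∀ χ ψ i x → restrict (χ ∙ᴴ ψ) i x ≡ restrict χ i (restrict ψ i x)
    restrict-∙ χ ψ i x = restrict-unique (χ ∙ᴴ ψ) i
      (trans (element-restrict χ i _) (cong (app (proj₁ χ)) (element-restrict ψ i x)))

    restrict-⁻¹ : ∀ χ i x → restrict (χ ⁻¹ᴴ) i x ≡ classPermutation χ i ⟨$⟩ˡ x
    restrict-⁻¹ χ i x = refl

    restrict-ε : ∀ i x → restrict εᴴ i x ≡ x
    restrict-ε i x = restrict-unique εᴴ i refl

    restrict-injective : ∀ χ χ' → (∀ i x → restrict χ i x ≡ restrict χ' i x) → χ ≈ᴴ χ'
    restrict-injective χ χ' χ≗χ' v = begin
      app (proj₁ χ) v                           ≡⟨ cong (app (proj₁ χ)) (element-index _ v refl) ⟨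
      app (proj₁ χ) (element (colour v) x)      ≡⟨ element-restrict χ _ x ⟨
      element (colour v) (restrict χ _ x)       ≡⟨ cong (element (colour v)) (χ≗χ' _ x) ⟩
      element (colour v) (restrict χ' _ x)      ≡⟨ element-restrict χ' _ x ⟩
      app (proj₁ χ') (element (colour v) x)     ≡⟨ cong (app (proj₁ χ')) (element-index _ v refl) ⟩
      app (proj₁ χ') v                          ∎
      where x = index (colour v) v refl

    assemble : ((i : Fin 5) → Fin (k i) → Fin (k i)) → Fin n → Fin n
    assemble p v = element (colour v) (p (colour v) (index (colour v) v refl))

    assemble-at : ∀ p v {i} (e : colour v ≡ i) → assemble p v ≡ element i (p i (index i v e))
    assemble-at p v refl = refl

    assemble-inverse : ∀ {p q} → (∀ i x → p i (q i x) ≡ x) → ∀ v → assemble p (assemble q v) ≡ v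
    assemble-inverse {p} {q} pq v = begin
      assemble p (assemble q v)
        ≡⟨ assemble-at p _ (colour-element _ _) ⟩
      element (colour v) (p (colour v) (index (colour v) (element (colour v) (q (colour v) x)) _))
        ≡⟨ cong (element (colour v) ∘ p (colour v)) (index-element _ _ _) ⟩
      element (colour v) (p (colour v) (q (colour v) x))
        ≡⟨ cong (element (colour v)) (pq _ x) ⟩
      element (colour v) x
        ≡⟨ element-index _ v refl ⟩
      v ∎
      where x = index (colour v) v refl

    assembleH : ((i : Fin 5) → Permutation′ (k i)) → HElt G ι
    assembleH p = proj₁ assembled , induced-id⇒InH (proj₁ assembled) (proj₂ assembled)
      where
      to from : (i : Fin 5) → Fin (k i) → Fin (k i)
      to i = p i ⟨$⟩ʳ_
      from i = p i ⟨$⟩ˡ_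
      assembled = blowUpAut (idAut C₅) (assemble to) (assemble from)
        (assemble-inverse {to} {from} (λ i _ → inverseʳ (p i)))
        (assemble-inverse {from} {to} (λ i _ → inverseˡ (p i)))
        (λ v → colour-element _ _)

    restrict-assembleH : ∀ p i x → restrict (assembleH p) i x ≡ p i ⟨$⟩ʳ x
    restrict-assembleH p i x = restrict-unique (assembleH p) i (sym
      (trans (assemble-at (λ j → p j ⟨$⟩ʳ_) (element i x) (colour-element i x))
             (cong (λ y → element i (p i ⟨$⟩ʳ y)) (index-element i x _))))

    H≅SymProd : HRaw G ι ≅ SymProd k
    H≅SymProd = mk≅ (HRaw G ι) (SymProd k) (λ χ → tabulate₅ (classPermutation χ))
      (λ {χ} {χ'} χ≈χ' → tabulate₅ (restrict-cong χ χ' χ≈χ'))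
      (λ χ ψ → tabulate₅ (restrict-∙ χ ψ))
      (tabulate₅ restrict-ε)
      (λ χ → tabulate₅ (restrict-⁻¹ χ))
      (λ {χ} {χ'} eq → restrict-injective χ χ' (lookup₅ eq))
      (λ ps → assembleH (lookup₅ ps) , λ {χ} χ≈ → tabulate₅ λ i t →
        trans (restrict-cong χ (assembleH (lookup₅ ps)) χ≈ i t) (restrict-assembleH (lookup₅ ps) i t))

  Aut/H≅Aut-C₅ : (∀ i → size i ≡ size 0F) → AutModH G ι ≅ AutRaw C₅
  Aut/H≅Aut-C₅ equal = mk≅ (AutModH G ι) (AutRaw C₅) inducedAut
    (λ {φ} {ψ} → sameCoset⇒sameInduced φ ψ) induced-∘ colour-ι (λ _ _ → refl)
    (λ {φ} {ψ} → sameInduced⇒sameCoset φ ψ)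
    λ τ → let (φ , φ≗τ) = liftAut (reindex equal (indexing colour)) τ in
      φ , λ {ψ} ψ≈φ i → trans (sameCoset⇒sameInduced ψ φ ψ≈φ i) (φ≗τ i)

  Aut/H≅ℤ₂ : ¬ (∃[ k ] Regular G k) → HasReflection G ι → AutModH G ι ≅ ℤ₂
  Aut/H≅ℤ₂ irregular reflection = mk≅ (AutModH G ι) ℤ₂ reflects
    (λ {φ} {ψ} φ≈ψ → reflects-cong φ ψ (sameCoset⇒sameInduced φ ψ φ≈ψ)) reflects-∙ reflects-ε reflects-⁻¹
    (λ {φ} {ψ} eq → irregular-rotation⇒InH irregular (compAut (invAut φ) ψ) (begin
      reflects (compAut (invAut φ) ψ)     ≡⟨ reflects-∙ (invAut φ) ψ ⟩
      reflects (invAut φ) xor reflects ψ  ≡⟨ cong (_xor reflects ψ) (trans (reflects-⁻¹ φ) eq) ⟩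
      reflects ψ xor reflects ψ           ≡⟨ xor-same (reflects ψ) ⟩
      false                               ∎))
    λ { false → idAut G , λ {ψ} ψ≈id →
          trans (reflects-cong ψ (idAut G) (sameCoset⇒sameInduced ψ (idAut G) ψ≈id)) reflects-ε
      ; true → φ , λ {ψ} ψ≈φ →
          trans (reflects-cong ψ φ (sameCoset⇒sameInduced ψ φ ψ≈φ)) (HasReflection⇒reflects reflection) }
    where φ = proj₁ reflection

mainTheorem5 : ∀ (n : ℕ) (G : Graph n) (ι : Fin 5 → Fin n) → Reseminant n G ι →
    ((∃[ k ] Regular G k) →
    ∃[ hh ] ((∀ i → h G ι i ≡ hh)
    × (AutModH G ι ≅ AutRaw C₅) × (AutRaw C₅ ≅ D₅)
    × (HRaw G ι ≅ SymProd (λ _ → hh))))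
    × ((¬ (∃[ k ] Regular G k)) → ¬ HasReflection G ι →
    (∀ (φ : Aut G) → InH ι φ) × (HRaw G ι ≅ SymProd (h G ι)))
    × ((¬ (∃[ k ] Regular G k)) → HasReflection G ι →
    AutModH G ι ≅ ℤ₂)
mainTheorem5 n G ι R =
    (λ regular → let equal = regular⇒equalSizes regular in
       size 0F , (λ i → trans (h≡size i) (equal i)) , Aut/H≅Aut-C₅ equal , Aut-C₅≅D₅ ,
       H≅SymProd (reindex equal (indexing colour)))
  , (λ irregular noReflection → irregular⇒InH irregular noReflection ,
       H≅SymProd (reindex (λ i → sym (h≡size i)) (indexing colour)))
  , Aut/H≅ℤ₂
  where
  B = reseminant⇒blowUp R
  open BlowUp B
  open BlowUpAutomorphisms B
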